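{- Let $n \geq 1$, $m \geq 1$ and $k \geq 2$ be integers, and let $w$ and $w'$ be $m$-weightings of the Sperner graph $B_n$ such that $w'$ is uniform on $\binom{[n]}{\lceil n/2 \rceil}$. Then $\pi_k(B_n(w')) \leq \pi_k(B_n(w))$.
   Context: All graphs are simple. $\mathbb{N}_0 = \{0,1,2,\dots\}$, $[n]=\{1,\dots,n\}$, and $\binom{X}{k}$ is the set of $k$-element subsets of $X$. For a graph $G$, a function $w: V(G) \to \mathbb{N}_0$ with $\sum_{v \in V(G)} w(v) = m$ is an $m$-weighting of $G$. $G(w)$ is the graph obtained from $G$ by replacing each vertex $v$ by a clique $K^v$ on $w(v)$ vertices and joining every vertex of $K^u$ to every vertex of $K^v$ whenever $uv \in E(G)$ (formally $V(G(w)) = \{(v,i): v\in V(G), i \in [w(v)]\}$, with $(u,i)(v,j)$ an edge iff $u=v$ and $i\neq j$, or $uv \in E(G)$). $\pi_k(H)$ denotes the number of $k$-cliques (complete subgraphs on $k$ vertices) of a graph $H$. For $U \subseteq V(G)$, an $m$-weighting $w$ is uniform on $U$ if $w(v)=0$ for all $v \notin U$ and $w(u) \in \{\lfloor m/|U|\rfloor, \lceil m/|U| \rceil\}$ for all $u \in U$. The Sperner graph $B_n$ has vertex set $2^{[n]}$ (all subsets of $[n]$) and edges $XY$ for all $X \subsetneq Y \subseteq [n]$. -}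

module Defs where

open import Data.Nat using (ℕ; zero; suc; _+_; _∸_; ⌈_/2⌉)
open import Data.Nat.DivMod using (_/_)
open import Data.Bool using (Bool; true; false)
import Data.Bool.Properties as BoolP
open import Data.Fin using (Fin)
open import Data.Fin.Subset using (Subset; _⊆_; ∣_∣)
open import Data.Fin.Subset.Properties using (_⊆?_)
open import Data.Vec using (Vec; []; _∷_)
import Data.Vec.Properties as VecP
open import Data.List using (List; []; _∷_; _++_; map; concatMap; filter; length; allFin)
open import Data.Nat.ListAction using (sum)
open import Data.List.Relation.Unary.AllPairs using (AllPairs)
open import Data.List.Relation.Unary.AllPairs.Properties using ()
import Data.List.Relation.Unary.AllPairs as AP
open import Data.Product using (Σ; _,_; _×_)
open import Data.Sum using (_⊎_)
open import Relation.Nullary using (¬_; Dec; yes; no)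
open import Relation.Nullary.Decidable using (_×-dec_; _⊎-dec_; ¬?)
open import Relation.Binary.PropositionalEquality using (_≡_; _≢_)
open import Relation.Binary.Definitions using (DecidableEquality)
import Data.Fin.Properties as FinP

record FinGraph : Set₁ where
  field
    Vtx   : Set
    verts : List Vtx            -- every vertex exactly once
    _≟V_  : DecidableEquality Vtx
    Adj   : Vtx → Vtx → Set
    adj?  : (u v : Vtx) → Dec (Adj u v)

open FinGraph public

-- all k-element sublists (= k-element subsets, for duplicate-free lists)
choose : {A : Set} → ℕ → List A → List (List A)
choose zero    xs       = [] ∷ []
choose (suc k) []       = []
choose (suc k) (x ∷ xs) = map (x ∷_) (choose k xs) ++ choose (suc k) xs

π : ℕ → FinGraph → ℕ
π k H = length (filter (AP.allPairs? (adj? H)) (choose k (verts H)))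

IsWeighting : (G : FinGraph) → (Vtx G → ℕ) → ℕ → Set
IsWeighting G w m = sum (map w (verts G)) ≡ m

-- blow-up G(w); first disjunct: same clique K^v, distinct copies
BlowAdj : (G : FinGraph) (w : Vtx G → ℕ) → Σ (Vtx G) (λ v → Fin (w v)) → Σ (Vtx G) (λ v → Fin (w v)) → Set
BlowAdj G w (u , i) (v , j) = (Σ (u ≡ v) (λ _ → ¬ (Data.Fin.toℕ i ≡ Data.Fin.toℕ j))) ⊎ Adj G u v

blowAdj? : (G : FinGraph) (w : Vtx G → ℕ) → (x y : Σ (Vtx G) (λ v → Fin (w v))) → Dec (BlowAdj G w x y)
blowAdj? G w (u , i) (v , j) = (_≟V_ G u v ×-dec ¬? (Data.Nat._≟_ (Data.Fin.toℕ i) (Data.Fin.toℕ j))) ⊎-dec adj? G u v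

blowUp : (G : FinGraph) → (Vtx G → ℕ) → FinGraph
blowUp G w = record
  { Vtx   = Σ (Vtx G) (λ v → Fin (w v))
  ; verts = concatMap (λ v → map (v ,_) (allFin (w v))) (verts G)
  ; _≟V_  = dec
  ; Adj   = BlowAdj G w
  ; adj?  = blowAdj? G w
  }
  where
  open import Data.Product.Properties using (≡-dec)
  dec : DecidableEquality (Σ (Vtx G) (λ v → Fin (w v)))
  dec = Data.Product.Properties.≡-dec (_≟V_ G) FinP._≟_

allSubsets : (n : ℕ) → List (Subset n)
allSubsets zero    = [] ∷ []
allSubsets (suc n) = map (true ∷_) (allSubsets n) ++ map (false ∷_) (allSubsets n)

_⊊_ : {n : ℕ} → Subset n → Subset n → Set
X ⊊ Y = X ⊆ Y × X ≢ Y

_⊊?_ : {n : ℕ} → (X Y : Subset n) → Dec (X ⊊ Y)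
X ⊊? Y = (X ⊆? Y) ×-dec ¬? (VecP.≡-dec BoolP._≟_ X Y)

Sperner : ℕ → FinGraph
Sperner n = record
  { Vtx   = Subset n
  ; verts = allSubsets n
  ; _≟V_  = VecP.≡-dec BoolP._≟_
  ; Adj   = λ X Y → X ⊊ Y ⊎ Y ⊊ X
  ; adj?  = λ X Y → (X ⊊? Y) ⊎-dec (Y ⊊? X)
  }

-- floor / ceiling division (only used with nonzero divisor)

⌊_/_⌋ : ℕ → ℕ → ℕ
⌊ m / zero  ⌋ = 0
⌊ m / suc d ⌋ = m / suc d

⌈_/_⌉ : ℕ → ℕ → ℕ
⌈ m / zero  ⌉ = 0
⌈ m / suc d ⌉ = (m + d) / suc d

InMiddle : (n : ℕ) → Subset n → Set
InMiddle n X = ∣ X ∣ ≡ ⌈ n /2⌉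

middleLayer : (n : ℕ) → List (Subset n)
middleLayer n = filter (λ X → Data.Nat._≟_ ∣ X ∣ ⌈ n /2⌉) (allSubsets n)

UniformOnMiddle : (n : ℕ) → (Subset n → ℕ) → ℕ → Set
UniformOnMiddle n w m =
  ((X : Subset n) → ¬ InMiddle n X → w X ≡ 0) ×
  ((X : Subset n) → InMiddle n X →
     (w X ≡ ⌊ m / length (middleLayer n) ⌋) ⊎ (w X ≡ ⌈ m / length (middleLayer n) ⌉))

{-# OPTIONS --safe #-}
module Submission where

-- Split B_n into symmetric chains (de Bruijn, Tengbergen and Kruyswijk). Each chain blows up to a
-- clique of B_n(w), so π_k(B_n(w)) ≥ Σ_K C(w(K), k) over the chains K; there are at most
-- N = |([n] choose ⌈n/2⌉)| chains because every symmetric chain meets the middle layer.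
-- On the other hand w′ lives on the middle layer, an antichain, so π_k(B_n(w′)) = Σ_X C(w′(X), k).
-- As x ↦ C(x, k) lies above its secant through q = ⌊m/N⌋ and q + 1, where all values of w′ lie,
-- the discrete Jensen inequality gives Σ_X C(w′(X), k) ≤ Σ_K C(w(K), k); having fewer than N
-- chains only helps, since C(q, k) ≤ q C(q, k - 1).

open import Defs
open import Algebra.Bundles using (CommutativeMonoid)
import Algebra.Properties.CommutativeSemigroup as CommutativeSemigroupProperties
open import Data.Bool using (Bool; true; false; _∧_; T; if_then_else_)
open import Data.Bool.Properties using (T-∧; T-≡; ∧-assoc; ∧-comm)
open import Data.Empty using (⊥-elim)
open import Data.Fin using (Fin)
open import Data.Fin.Properties using (¬Fin0; toℕ-injective)
open import Data.Fin.Subset using (Subset; _⊆_; ∣_∣)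
open import Data.Fin.Subset.Properties using (⊆-refl; s⊆s; out⊆; drop-∷-⊆; p⊆q⇒∣p∣≤∣q∣)
open import Data.List using (List; []; _∷_; _++_; map; concat; concatMap; filter; length; allFin)
open import Data.List.Properties
  using (++-identityʳ; map-++; map-∘; map-cong; concatMap-++; length-++; length-map; length-tabulate;
         filter-++; filter-accept; filter-none; filter-some)
open import Data.List.Relation.Unary.All as All using (All; []; _∷_)
import Data.List.Relation.Unary.All.Properties as All
open import Data.List.Relation.Unary.AllPairs as AP using (AllPairs; []; _∷_)
import Data.List.Relation.Unary.AllPairs.Properties as AllPairs
open import Data.List.Relation.Unary.Any using (Any; here; there)
open import Data.List.Relation.Unary.Unique.Propositional.Properties using (allFin⁺)
open import Data.List.Relation.Binary.Permutation.Propositional as ↭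
  using (_↭_; ↭-refl; ↭-reflexive; ↭-trans; prep; module PermutationReasoning)
open import Data.List.Relation.Binary.Permutation.Propositional.Properties
  using (++⁺; ++⁺ˡ; ++-comm; shifts; map⁺; filter-↭; ↭-length; ++-commutativeMonoid)
open import Data.Nat using (ℕ; zero; suc; _+_; _*_; _∸_; _≤_; _≥_; z≤n; s≤s; ⌈_/2⌉)
open import Data.Nat.Combinatorics using (_C_; nCk+nC[k+1]≡[n+1]C[k+1])
open import Data.Nat.DivMod using (_/_; /-monoˡ-≤; m/n≡1+[m∸n]/n)
open import Data.Nat.ListAction using (sum)
open import Data.Nat.ListAction.Properties using (sum-++; sum-↭)
open import Data.Nat.Properties
open import Data.Nat.Tactic.RingSolver using (solve-∀)
open import Data.Product using (_×_; _,_; proj₁; proj₂)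
import Data.Product as Product
open import Data.Sum using (_⊎_; inj₁; inj₂; [_,_]; [_,_]′)
import Data.Sum as Sum
open import Data.Unit using (tt)
open import Data.Vec using ([]; _∷_; here)
open import Data.Vec.Properties using (∷-injectiveʳ)
open import Function using (_∘_; const)
open import Function.Bundles using (_⇔_; mk⇔; Equivalence)
open import Relation.Binary using (Symmetric)
import Relation.Binary as Binary
open import Relation.Binary.PropositionalEquality hiding ([_])
open import Relation.Nullary using (¬_; yes; no; contradiction)
open import Relation.Nullary.Decidable using (isYes; toWitness; fromWitness)
open import Relation.Unary using (Decidable)

open Equivalence using (to; from)
open CommutativeSemigroupProperties +-commutativeSemigroup using (interchange; x∙yz≈y∙xz; xy∙z≈y∙xz)

filter-map : ∀ {A B : Set} {P : B → Set} (P? : Decidable P) (f : A → B) xs →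
             filter P? (map f xs) ≡ map f (filter (P? ∘ f) xs)
filter-map P? f []       = refl
filter-map P? f (x ∷ xs) with P? (f x)
... | yes _ = cong (f x ∷_) (filter-map P? f xs)
... | no  _ = filter-map P? f xs

concatMap⁺ : ∀ {A B : Set} (f : A → List B) {xs ys} → xs ↭ ys → concatMap f xs ↭ concatMap f ys
concatMap⁺ f ↭.refl         = ↭-refl
concatMap⁺ f (↭.prep x p)   = ++⁺ˡ (f x) (concatMap⁺ f p)
concatMap⁺ f (↭.swap x y p) = ↭-trans (shifts (f x) (f y)) (++⁺ˡ (f y) (++⁺ˡ (f x) (concatMap⁺ f p)))
concatMap⁺ f (↭.trans p q)  = ↭-trans (concatMap⁺ f p) (concatMap⁺ f q)

concatMap-concat : ∀ {A B : Set} (f : A → List B) xss →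
                   concatMap f (concat xss) ≡ concat (map (concatMap f) xss)
concatMap-concat f []         = refl
concatMap-concat f (xs ∷ xss) =
  trans (concatMap-++ f xs (concat xss)) (cong (concatMap f xs ++_) (concatMap-concat f xss))

sum-map-concat : ∀ {A : Set} (f : A → ℕ) xss → sum (map f (concat xss)) ≡ sum (map (sum ∘ map f) xss)
sum-map-concat f []         = refl
sum-map-concat f (xs ∷ xss) = begin
  sum (map f (xs ++ concat xss))             ≡⟨ cong sum (map-++ f xs (concat xss)) ⟩
  sum (map f xs ++ map f (concat xss))       ≡⟨ sum-++ (map f xs) _ ⟩
  sum (map f xs) + sum (map f (concat xss))  ≡⟨ cong (sum (map f xs) +_) (sum-map-concat f xss) ⟩
  sum (map f xs) + sum (map (sum ∘ map f) xss) ∎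
  where open ≡-Reasoning

sum-map-filter : ∀ {A : Set} {P : A → Set} (P? : Decidable P) (f : A → ℕ) → (∀ x → ¬ P x → f x ≡ 0) →
                 ∀ xs → sum (map f (filter P? xs)) ≡ sum (map f xs)
sum-map-filter P? f f≡0 []       = refl
sum-map-filter P? f f≡0 (x ∷ xs) with P? x
... | yes _  = cong (f x +_) (sum-map-filter P? f f≡0 xs)
... | no ¬Px = trans (sum-map-filter P? f f≡0 xs) (cong (_+ sum (map f xs)) (sym (f≡0 x ¬Px)))

length-≤-filter-concatMap : ∀ {A B : Set} {P : B → Set} (P? : Decidable P) (f : A → List B) xs →
                            All (Any P ∘ f) xs → length xs ≤ length (filter P? (concatMap f xs))
length-≤-filter-concatMap P? f []       []       = z≤n
length-≤-filter-concatMap P? f (x ∷ xs) (a ∷ as) = begin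
  suc (length xs)
    ≤⟨ +-mono-≤ (filter-some P? a) (length-≤-filter-concatMap P? f xs as) ⟩
  length (filter P? (f x)) + length (filter P? (concatMap f xs))
    ≡⟨ length-++ (filter P? (f x)) ⟨
  length (filter P? (f x) ++ filter P? (concatMap f xs))
    ≡⟨ cong length (filter-++ P? (f x) _) ⟨
  length (filter P? (concatMap f (x ∷ xs))) ∎
  where open ≤-Reasoning

-- Counting cliques

_·_ : Bool → ℕ → ℕ
b · n = if b then n else 0

·-≤ : ∀ b n → b · n ≤ n
·-≤ true  n = ≤-refl
·-≤ false n = z≤n

·-monoʳ-≤ : ∀ b {m n} → m ≤ n → b · m ≤ b · n
·-monoʳ-≤ true  m≤n = m≤n
·-monoʳ-≤ false _   = z≤n

·-exchange : ∀ a b c N₁ N₂ N₃ N₄ →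
             a · ((b ∧ c) · N₁ + N₂) + (b · N₃ + N₄) ≡ b · ((a ∧ c) · N₁ + N₃) + (a · N₂ + N₄)
·-exchange true  true  c N₁ N₂ N₃ N₄ = interchange (c · N₁) N₂ N₃ N₄
·-exchange true  false _ _  _  _  _  = refl
·-exchange false _     _ _  _  _  _  = refl

¬T⇒≡false : ∀ {b} → ¬ T b → b ≡ false
¬T⇒≡false {false} _  = refl
¬T⇒≡false {true}  ¬t = ⊥-elim (¬t tt)

module CliqueCounting {A : Set} {R : A → A → Set} (R? : Binary.Decidable R) where

  adjacent : A → A → Bool
  adjacent x y = isYes (R? x y)

  _∩_ : (A → Bool) → (A → Bool) → A → Bool
  (S ∩ S′) y = S y ∧ S′ y

  #cliquesIn : ℕ → (A → Bool) → List A → ℕ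
  #cliquesIn zero    S L       = 1
  #cliquesIn (suc k) S []      = 0
  #cliquesIn (suc k) S (x ∷ L) = S x · #cliquesIn k (S ∩ adjacent x) L + #cliquesIn (suc k) S L

  #cliques : ℕ → List A → ℕ
  #cliques k = #cliquesIn k (const true)

  T-∩-adjacent : ∀ S x {y} → T ((S ∩ adjacent x) y) ⇔ (T (S y) × R x y)
  T-∩-adjacent S x = mk⇔ (λ t → let s , r = to T-∧ t in s , toWitness r)
                         (λ (s , r) → from T-∧ (s , fromWitness r))

  All-∩-adjacent : ∀ S x {ys} → All (T ∘ (S ∩ adjacent x)) ys ⇔ (All (T ∘ S) ys × All (R x) ys)
  All-∩-adjacent S x = mk⇔ (All.unzipWith (to (T-∩-adjacent S x))) (All.zipWith (from (T-∩-adjacent S x)))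

  length-filter-choose : ∀ k S L {Q : List A → Set} (Q? : Decidable Q) →
                         (∀ ys → Q ys ⇔ (All (T ∘ S) ys × AllPairs R ys)) →
                         length (filter Q? (choose k L)) ≡ #cliquesIn k S L
  length-filter-choose zero    S L       Q? Q⇔ = cong length (filter-accept Q? (from (Q⇔ []) ([] , [])))
  length-filter-choose (suc k) S []      Q? Q⇔ = refl
  length-filter-choose (suc k) S (x ∷ L) {Q} Q? Q⇔ = begin
    length (filter Q? (map x∷ (choose k L) ++ choose (suc k) L))
      ≡⟨ cong length (filter-++ Q? (map x∷ (choose k L)) _) ⟩
    length (filter Q? (map x∷ (choose k L)) ++ filter Q? (choose (suc k) L))
      ≡⟨ length-++ (filter Q? (map x∷ (choose k L))) ⟩
    length (filter Q? (map x∷ (choose k L))) + length (filter Q? (choose (suc k) L))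
      ≡⟨ cong₂ _+_ (cong length (filter-map Q? x∷ (choose k L))) (length-filter-choose (suc k) S L Q? Q⇔) ⟩
    length (map x∷ (filter (Q? ∘ x∷) (choose k L))) + #cliquesIn (suc k) S L
      ≡⟨ cong (_+ #cliquesIn (suc k) S L)
              (trans (length-map x∷ (filter (Q? ∘ x∷) (choose k L))) (containing-x (S x) refl)) ⟩
    S x · #cliquesIn k (S ∩ adjacent x) L + #cliquesIn (suc k) S L ∎
    where
    open ≡-Reasoning
    x∷ : List A → List A
    x∷ ys = x ∷ ys
    containing-x : ∀ b → S x ≡ b →
                   length (filter (Q? ∘ x∷) (choose k L)) ≡ b · #cliquesIn k (S ∩ adjacent x) L
    containing-x true  Sx = length-filter-choose k (S ∩ adjacent x) L (Q? ∘ x∷) λ ys → mk⇔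
      (λ q → let s , r = to (Q⇔ (x ∷ ys)) q in from (All-∩-adjacent S x) (All.tail s , AP.head r) , AP.tail r)
      (λ (s , rs) → let s′ , r = to (All-∩-adjacent S x) s in
                    from (Q⇔ (x ∷ ys)) (subst T (sym Sx) tt ∷ s′ , r ∷ rs))
    containing-x false Sx = cong length (filter-none (Q? ∘ x∷) {choose k L} (All.universal excluded _))
      where
      excluded : ∀ ys → ¬ Q (x ∷ ys)
      excluded ys q = subst T Sx (All.head (proj₁ (to (Q⇔ (x ∷ ys)) q)))

  #cliquesIn-cong : ∀ k {S S′} L → S ≗ S′ → #cliquesIn k S L ≡ #cliquesIn k S′ L
  #cliquesIn-cong zero    L       S≗S′ = refl
  #cliquesIn-cong (suc k) []      S≗S′ = refl
  #cliquesIn-cong (suc k) (x ∷ L) S≗S′ =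
    cong₂ _+_ (cong₂ _·_ (S≗S′ x) (#cliquesIn-cong k L (λ y → cong (_∧ adjacent x y) (S≗S′ y))))
              (#cliquesIn-cong (suc k) L S≗S′)

  #cliquesIn-++-mono : ∀ k S xs ys → #cliquesIn k S xs ≤ #cliquesIn k S (xs ++ ys)
  #cliquesIn-++-mono zero    S xs       ys = ≤-refl
  #cliquesIn-++-mono (suc k) S []       ys = z≤n
  #cliquesIn-++-mono (suc k) S (x ∷ xs) ys =
    +-mono-≤ (·-monoʳ-≤ (S x) (#cliquesIn-++-mono k _ xs ys)) (#cliquesIn-++-mono (suc k) S xs ys)

  #cliquesIn-++-superadditive : ∀ k S xs ys →
    #cliquesIn (suc k) S xs + #cliquesIn (suc k) S ys ≤ #cliquesIn (suc k) S (xs ++ ys)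
  #cliquesIn-++-superadditive k S []       ys = ≤-refl
  #cliquesIn-++-superadditive k S (x ∷ xs) ys = begin
    S x · #cliquesIn k Sx xs + #cliquesIn (suc k) S xs + #cliquesIn (suc k) S ys
      ≡⟨ +-assoc (S x · #cliquesIn k Sx xs) _ _ ⟩
    S x · #cliquesIn k Sx xs + (#cliquesIn (suc k) S xs + #cliquesIn (suc k) S ys)
      ≤⟨ +-mono-≤ (·-monoʳ-≤ (S x) (#cliquesIn-++-mono k Sx xs ys)) (#cliquesIn-++-superadditive k S xs ys) ⟩
    S x · #cliquesIn k Sx (xs ++ ys) + #cliquesIn (suc k) S (xs ++ ys) ∎
    where
    open ≤-Reasoning
    Sx : A → Bool
    Sx = S ∩ adjacent x

  #cliquesIn-clique : ∀ k S L → AllPairs R L → All (T ∘ S) L → #cliquesIn k S L ≡ length L C k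
  #cliquesIn-clique zero    S L       _         _         = refl
  #cliquesIn-clique (suc k) S []      _         _         = refl
  #cliquesIn-clique (suc k) S (x ∷ L) (Rx ∷ RL) (Sx ∷ SL) rewrite to T-≡ Sx =
    trans (cong₂ _+_ (#cliquesIn-clique k _ L RL (from (All-∩-adjacent S x) (SL , Rx)))
                     (#cliquesIn-clique (suc k) S L RL SL))
          (nCk+nC[k+1]≡[n+1]C[k+1] (length L) k)

  #cliquesIn-≤-C : ∀ k S L → #cliquesIn k S L ≤ length L C k
  #cliquesIn-≤-C zero    S L       = ≤-refl
  #cliquesIn-≤-C (suc k) S []      = ≤-refl
  #cliquesIn-≤-C (suc k) S (x ∷ L) =
    ≤-trans (+-mono-≤ (≤-trans (·-≤ (S x) _) (#cliquesIn-≤-C k _ L)) (#cliquesIn-≤-C (suc k) S L))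
            (≤-reflexive (nCk+nC[k+1]≡[n+1]C[k+1] (length L) k))

  #cliquesIn-++-rejected : ∀ k S xs ys → All (¬_ ∘ T ∘ S) ys → #cliquesIn k S (xs ++ ys) ≡ #cliquesIn k S xs
  #cliquesIn-++-rejected zero    S xs       ys       _          = refl
  #cliquesIn-++-rejected (suc k) S []       []       _          = refl
  #cliquesIn-++-rejected (suc k) S []       (y ∷ ys) (¬Sy ∷ ¬S) rewrite ¬T⇒≡false ¬Sy =
    #cliquesIn-++-rejected (suc k) S [] ys ¬S
  #cliquesIn-++-rejected (suc k) S (x ∷ xs) ys       ¬S         =
    cong₂ _+_ (cong (S x ·_) (#cliquesIn-++-rejected k _ xs ys (All.map (_∘ proj₁ ∘ to T-∧) ¬S)))
              (#cliquesIn-++-rejected (suc k) S xs ys ¬S)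

  #cliquesIn-++-independent : ∀ k S xs ys → All (λ x → All (¬_ ∘ R x) ys) xs →
    #cliquesIn (suc k) S (xs ++ ys) ≡ #cliquesIn (suc k) S xs + #cliquesIn (suc k) S ys
  #cliquesIn-++-independent k S []       ys _          = refl
  #cliquesIn-++-independent k S (x ∷ xs) ys (¬Rx ∷ ¬R) =
    trans (cong₂ _+_ (cong (S x ·_) (#cliquesIn-++-rejected k _ xs ys non-neighbours))
                     (#cliquesIn-++-independent k S xs ys ¬R))
          (sym (+-assoc (S x · #cliquesIn k (S ∩ adjacent x) xs) _ _))
    where
    non-neighbours : All (¬_ ∘ T ∘ (S ∩ adjacent x)) ys
    non-neighbours = All.map (λ ¬r → ¬r ∘ proj₂ ∘ to (T-∩-adjacent S x)) ¬Rx

  module _ (R-sym : Symmetric R) where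

    adjacent-sym : ∀ x y → adjacent x y ≡ adjacent y x
    adjacent-sym x y with R? x y | R? y x
    ... | yes _   | yes _   = refl
    ... | no  _   | no  _   = refl
    ... | yes Rxy | no ¬Ryx = ⊥-elim (¬Ryx (R-sym Rxy))
    ... | no ¬Rxy | yes Ryx = ⊥-elim (¬Rxy (R-sym Ryx))

    #cliquesIn-swap : ∀ k S x y L → #cliquesIn k S (x ∷ y ∷ L) ≡ #cliquesIn k S (y ∷ x ∷ L)
    #cliquesIn-swap zero          S x y L = refl
    #cliquesIn-swap (suc zero)    S x y L = x∙yz≈y∙xz (S x · 1) (S y · 1) _
    #cliquesIn-swap (suc (suc k)) S x y L =
      trans (·-exchange (S x) (S y) (adjacent x y) _ _ _ _)
            (cong₂ (λ a N → S y · ((S x ∧ a) · N + _) + _) (adjacent-sym x y) (#cliquesIn-cong k L reorder))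
      where
      reorder : ∀ z → (S z ∧ adjacent x z) ∧ adjacent y z ≡ (S z ∧ adjacent y z) ∧ adjacent x z
      reorder z = trans (∧-assoc (S z) _ _) (trans (cong (S z ∧_) (∧-comm (adjacent x z) _)) (sym (∧-assoc (S z) _ _)))

    #cliquesIn-∷ : ∀ x {xs ys} → (∀ k S → #cliquesIn k S xs ≡ #cliquesIn k S ys) →
                   ∀ k S → #cliquesIn k S (x ∷ xs) ≡ #cliquesIn k S (x ∷ ys)
    #cliquesIn-∷ x eq zero    S = refl
    #cliquesIn-∷ x eq (suc k) S = cong₂ _+_ (cong (S x ·_) (eq k _)) (eq (suc k) S)

    #cliquesIn-↭ : ∀ {xs ys} → xs ↭ ys → ∀ k S → #cliquesIn k S xs ≡ #cliquesIn k S ys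
    #cliquesIn-↭ ↭.refl         k S = refl
    #cliquesIn-↭ (↭.prep x p)   = #cliquesIn-∷ x (#cliquesIn-↭ p)
    #cliquesIn-↭ (↭.swap x y p) k S =
      trans (#cliquesIn-swap k S x y _) (#cliquesIn-∷ y (#cliquesIn-∷ x (#cliquesIn-↭ p)) k S)
    #cliquesIn-↭ (↭.trans p q)  k S = trans (#cliquesIn-↭ p k S) (#cliquesIn-↭ q k S)

  sum-C-≤-#cliques-concat : ∀ k bs → All (AllPairs R) bs →
                            sum (map (λ b → length b C suc k) bs) ≤ #cliques (suc k) (concat bs)
  sum-C-≤-#cliques-concat k []       []       = z≤n
  sum-C-≤-#cliques-concat k (b ∷ bs) (Kb ∷ K) =
    ≤-trans (+-mono-≤ (≤-reflexive (sym (#cliquesIn-clique (suc k) _ b Kb (All.universal (const tt) b))))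
                      (sum-C-≤-#cliques-concat k bs K))
            (#cliquesIn-++-superadditive k _ b (concat bs))

  #cliques-concat-≤-sum-C : ∀ k bs → AllPairs (λ b b′ → All (λ x → All (¬_ ∘ R x) b′) b) bs →
                            #cliques (suc k) (concat bs) ≤ sum (map (λ b → length b C suc k) bs)
  #cliques-concat-≤-sum-C k []       []       = z≤n
  #cliques-concat-≤-sum-C k (b ∷ bs) (I ∷ Is) =
    ≤-trans (≤-reflexive (#cliquesIn-++-independent k _ b (concat bs) (All.map All.concat⁺ (All.All-swap I))))
            (+-mono-≤ (#cliquesIn-≤-C (suc k) _ b) (#cliques-concat-≤-sum-C k bs Is))

-- Binomial coefficients

nCk≤[1+n]Ck : ∀ n k → n C k ≤ suc n C k
nCk≤[1+n]Ck n zero    = ≤-refl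
nCk≤[1+n]Ck n (suc k) = ≤-trans (m≤n+m (n C suc k) (n C k)) (≤-reflexive (nCk+nC[k+1]≡[n+1]C[k+1] n k))

nCk≤[d+n]Ck : ∀ d n k → n C k ≤ (d + n) C k
nCk≤[d+n]Ck zero    n k = ≤-refl
nCk≤[d+n]Ck (suc d) n k = ≤-trans (nCk≤[d+n]Ck d n k) (nCk≤[1+n]Ck (d + n) k)

qC[1+j]+d*qCj≤[d+q]C[1+j] : ∀ d q j → q C suc j + d * (q C j) ≤ (d + q) C suc j
qC[1+j]+d*qCj≤[d+q]C[1+j] zero    q j = ≤-reflexive (+-identityʳ (q C suc j))
qC[1+j]+d*qCj≤[d+q]C[1+j] (suc d) q j = begin
  q C suc j + (q C j + d * (q C j))  ≡⟨ x∙yz≈y∙xz (q C suc j) (q C j) (d * (q C j)) ⟩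
  q C j + (q C suc j + d * (q C j))  ≤⟨ +-mono-≤ (nCk≤[d+n]Ck d q j) (qC[1+j]+d*qCj≤[d+q]C[1+j] d q j) ⟩
  (d + q) C j + (d + q) C suc j      ≡⟨ nCk+nC[k+1]≡[n+1]C[k+1] (d + q) j ⟩
  suc (d + q) C suc j                ∎
  where open ≤-Reasoning

[d+x]C[1+j]≤xC[1+j]+d*[d+x]Cj : ∀ d x j → (d + x) C suc j ≤ x C suc j + d * ((d + x) C j)
[d+x]C[1+j]≤xC[1+j]+d*[d+x]Cj zero    x j = ≤-reflexive (sym (+-identityʳ (x C suc j)))
[d+x]C[1+j]≤xC[1+j]+d*[d+x]Cj (suc d) x j = begin
  suc (d + x) C suc j                          ≡⟨ nCk+nC[k+1]≡[n+1]C[k+1] (d + x) j ⟨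
  (d + x) C j + (d + x) C suc j                ≤⟨ +-monoʳ-≤ ((d + x) C j) ([d+x]C[1+j]≤xC[1+j]+d*[d+x]Cj d x j) ⟩
  (d + x) C j + (x C suc j + d * ((d + x) C j)) ≤⟨ +-mono-≤ E′≤E (+-monoʳ-≤ _ (*-monoʳ-≤ d E′≤E)) ⟩
  E + (x C suc j + d * E)                      ≡⟨ x∙yz≈y∙xz E (x C suc j) (d * E) ⟩
  x C suc j + suc d * E                        ∎
  where
  open ≤-Reasoning
  E : ℕ
  E = suc (d + x) C j
  E′≤E : (d + x) C j ≤ E
  E′≤E = nCk≤[1+n]Ck (d + x) j

-- The secant of C(·, j+1) through q and q + 1 is x ↦ C(q, j+1) + (x - q) C(q, j); the next two
-- lemmas say that C(·, j+1) lies above it and meets it at q and q + 1, with the subtraction moved away.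

C-above-secant : ∀ q j x → q C suc j + x * (q C j) ≤ x C suc j + q * (q C j)
C-above-secant q j x with ≤-total x q
... | inj₁ x≤q =
  subst (λ q → q C suc j + x * (q C j) ≤ x C suc j + q * (q C j)) (m∸n+n≡m x≤q) (below (q ∸ x))
  where
  below : ∀ d → (d + x) C suc j + x * ((d + x) C j) ≤ x C suc j + (d + x) * ((d + x) C j)
  below d = begin
    (d + x) C suc j + x * E      ≤⟨ +-monoˡ-≤ (x * E) ([d+x]C[1+j]≤xC[1+j]+d*[d+x]Cj d x j) ⟩
    x C suc j + d * E + x * E    ≡⟨ +-assoc (x C suc j) (d * E) (x * E) ⟩
    x C suc j + (d * E + x * E)  ≡⟨ cong (x C suc j +_) (*-distribʳ-+ E d x) ⟨
    x C suc j + (d + x) * E      ∎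
    where
    open ≤-Reasoning
    E : ℕ
    E = (d + x) C j
... | inj₂ q≤x =
  subst (λ x → q C suc j + x * (q C j) ≤ x C suc j + q * (q C j)) (m∸n+n≡m q≤x) (above (x ∸ q))
  where
  above : ∀ d → q C suc j + (d + q) * (q C j) ≤ (d + q) C suc j + q * (q C j)
  above d = begin
    q C suc j + (d + q) * D      ≡⟨ cong (q C suc j +_) (*-distribʳ-+ D d q) ⟩
    q C suc j + (d * D + q * D)  ≡⟨ +-assoc (q C suc j) (d * D) (q * D) ⟨
    q C suc j + d * D + q * D    ≤⟨ +-monoˡ-≤ (q * D) (qC[1+j]+d*qCj≤[d+q]C[1+j] d q j) ⟩
    (d + q) C suc j + q * D      ∎
    where
    open ≤-Reasoning
    D : ℕ
    D = q C j

C-on-secant : ∀ q j x → x ≡ q ⊎ x ≡ suc q → x C suc j + q * (q C j) ≤ q C suc j + x * (q C j)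
C-on-secant q j x (inj₁ refl) = ≤-refl
C-on-secant q j x (inj₂ refl) = ≤-reflexive (begin
  suc q C suc j + q * (q C j)      ≡⟨ cong (_+ q * (q C j)) (nCk+nC[k+1]≡[n+1]C[k+1] q j) ⟨
  q C j + q C suc j + q * (q C j)  ≡⟨ xy∙z≈y∙xz (q C j) (q C suc j) (q * (q C j)) ⟩
  q C suc j + suc q * (q C j)      ∎)
  where open ≡-Reasoning

qC[1+j]≤q*qCj : ∀ q j → q C suc j ≤ q * (q C j)
qC[1+j]≤q*qCj q j = ≤-trans (≤-reflexive (sym (+-identityʳ (q C suc j)))) (C-above-secant q j 0)

module _ {X : Set} (f : X → ℕ) (q j : ℕ) where

  private
    B D A : ℕ
    B = q C suc j
    D = q C j
    A = q * D
    ΣC Σf : List X → ℕ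
    ΣC xs = sum (map (λ x → f x C suc j) xs)
    Σf xs = sum (map f xs)
    regroup : ∀ b y d lb s → (b + y * d) + (lb + s * d) ≡ (b + lb) + (y + s) * d
    regroup = solve-∀

  sum-C-on-secant : ∀ xs → All (λ x → f x ≡ q ⊎ f x ≡ suc q) xs →
    sum (map (λ x → f x C suc j) xs) + length xs * (q * (q C j)) ≤ length xs * (q C suc j) + sum (map f xs) * (q C j)
  sum-C-on-secant []       []       = z≤n
  sum-C-on-secant (x ∷ xs) (h ∷ hs) = begin
    f x C suc j + ΣC xs + (A + length xs * A)    ≡⟨ interchange (f x C suc j) (ΣC xs) A (length xs * A) ⟩
    (f x C suc j + A) + (ΣC xs + length xs * A)  ≤⟨ +-mono-≤ (C-on-secant q j (f x) h) (sum-C-on-secant xs hs) ⟩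
    (B + f x * D) + (length xs * B + Σf xs * D)  ≡⟨ regroup B (f x) D (length xs * B) (Σf xs) ⟩
    (B + length xs * B) + (f x + Σf xs) * D      ∎
    where open ≤-Reasoning

  sum-C-above-secant : ∀ xs →
    length xs * (q C suc j) + sum (map f xs) * (q C j) ≤ sum (map (λ x → f x C suc j) xs) + length xs * (q * (q C j))
  sum-C-above-secant []       = z≤n
  sum-C-above-secant (x ∷ xs) = begin
    (B + length xs * B) + (f x + Σf xs) * D      ≡⟨ regroup B (f x) D (length xs * B) (Σf xs) ⟨
    (B + f x * D) + (length xs * B + Σf xs * D)  ≤⟨ +-mono-≤ (C-above-secant q j (f x)) (sum-C-above-secant xs) ⟩
    (f x C suc j + A) + (ΣC xs + length xs * A)  ≡⟨ interchange (f x C suc j) A (ΣC xs) (length xs * A) ⟩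
    f x C suc j + ΣC xs + (A + length xs * A)    ∎
    where open ≤-Reasoning

sum-C-balanced-≤ : ∀ {X Y : Set} (f : X → ℕ) (g : Y → ℕ) q j xs ys →
  All (λ x → f x ≡ q ⊎ f x ≡ suc q) xs → sum (map f xs) ≡ sum (map g ys) → length ys ≤ length xs →
  sum (map (λ x → f x C suc j) xs) ≤ sum (map (λ y → g y C suc j) ys)
sum-C-balanced-≤ f g q j xs ys balanced Σf≡Σg c≤N
  with e , c+e≡N ← m≤n⇒∃[o]m+o≡n c≤N = +-cancelʳ-≤ (N * A) (ΣC f xs) (ΣC g ys) (begin
  ΣC f xs + N * A              ≤⟨ sum-C-on-secant f q j xs balanced ⟩
  N * B + Σf * D               ≡⟨ cong₂ (λ N s → N * B + s * D) (sym c+e≡N) Σf≡Σg ⟩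
  (c + e) * B + Σg * D         ≡⟨ split c e B Σg D ⟩
  e * B + (c * B + Σg * D)     ≤⟨ +-mono-≤ (*-monoʳ-≤ e (qC[1+j]≤q*qCj q j)) (sum-C-above-secant g q j ys) ⟩
  e * A + (ΣC g ys + c * A)    ≡⟨ merge e A (ΣC g ys) c ⟩
  ΣC g ys + (c + e) * A        ≡⟨ cong (λ N → ΣC g ys + N * A) c+e≡N ⟩
  ΣC g ys + N * A              ∎)
  where
  open ≤-Reasoning
  N c B D A Σf Σg : ℕ
  N = length xs
  c = length ys
  B = q C suc j
  D = q C j
  A = q * D
  Σf = sum (map f xs)
  Σg = sum (map g ys)
  ΣC : ∀ {Z : Set} → (Z → ℕ) → List Z → ℕ
  ΣC h zs = sum (map (λ z → h z C suc j) zs)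
  split : ∀ c e B s D → (c + e) * B + s * D ≡ e * B + (c * B + s * D)
  split = solve-∀
  merge : ∀ e A s c → e * A + (s + c * A) ≡ s + (c + e) * A
  merge = solve-∀

-- Blow-ups

π≡#cliques : ∀ k H → π k H ≡ CliqueCounting.#cliques (adj? H) k (verts H)
π≡#cliques k H = length-filter-choose k _ (verts H) (AP.allPairs? (adj? H))
                   λ ys → mk⇔ (λ K → All.universal (const tt) ys , K) proj₂
  where open CliqueCounting (adj? H)

module BlowUp (G : FinGraph) (w : Vtx G → ℕ) where

  open CliqueCounting (blowAdj? G w)

  copies : Vtx G → List (Vtx (blowUp G w))
  copies v = map (v ,_) (allFin (w v))

  All-copies : ∀ {P : Vtx (blowUp G w) → Set} v → (∀ i → P (v , i)) → All P (copies v)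
  All-copies v Pv = All.map⁺ (All.tabulate⁺ Pv)

  length-copies : ∀ v → length (copies v) ≡ w v
  length-copies v = trans (length-map {B = Vtx (blowUp G w)} (v ,_) (allFin (w v)))
                          (length-tabulate {A = Fin (w v)} (λ i → i))

  length-concatMap-copies : ∀ vs → length (concatMap copies vs) ≡ sum (map w vs)
  length-concatMap-copies []       = refl
  length-concatMap-copies (v ∷ vs) =
    trans (length-++ (copies v)) (cong₂ _+_ (length-copies v) (length-concatMap-copies vs))

  concatMap-copies-clique : ∀ {vs} → AllPairs (Adj G) vs → AllPairs (BlowAdj G w) (concatMap copies vs)
  concatMap-copies-clique {vs} K = AllPairs.concat⁺ (All.map⁺ (All.universal copies-clique vs))
    (AllPairs.map⁺ (AP.map (λ Auv → All-copies _ λ _ → All-copies _ λ _ → inj₂ Auv) K))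
    where
    copies-clique : ∀ v → AllPairs (BlowAdj G w) (copies v)
    copies-clique v = AllPairs.map⁺ (AP.map (λ i≢j → inj₁ (refl , i≢j ∘ toℕ-injective)) (allFin⁺ (w v)))

  blowAdj-sym : Symmetric (Adj G) → Symmetric (BlowAdj G w)
  blowAdj-sym Adj-sym (inj₁ (refl , i≢j)) = inj₁ (refl , i≢j ∘ sym)
  blowAdj-sym Adj-sym (inj₂ Auv)          = inj₂ (Adj-sym Auv)

  sum-C-≤-π : Symmetric (Adj G) → ∀ k (cs : List (List (Vtx G))) →
              All (AllPairs (Adj G)) cs → concat cs ↭ verts G →
              sum (map (λ c → sum (map w c) C suc k) cs) ≤ π (suc k) (blowUp G w)
  sum-C-≤-π Adj-sym k cs Ks cs↭G = begin
    sum (map (λ c → sum (map w c) C suc k) cs)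
      ≡⟨ cong sum (trans (map-cong (λ c → cong (_C suc k) (sym (length-concatMap-copies c))) cs) (map-∘ cs)) ⟩
    sum (map (λ b → length b C suc k) (map (concatMap copies) cs))
      ≤⟨ sum-C-≤-#cliques-concat k (map (concatMap copies) cs) (All.map⁺ (All.map concatMap-copies-clique Ks)) ⟩
    #cliques (suc k) (concat (map (concatMap copies) cs))
      ≡⟨ cong (#cliques (suc k)) (concatMap-concat copies cs) ⟨
    #cliques (suc k) (concatMap copies (concat cs))
      ≡⟨ #cliquesIn-↭ (blowAdj-sym Adj-sym) (concatMap⁺ copies cs↭G) (suc k) _ ⟩
    #cliques (suc k) (verts (blowUp G w))
      ≡⟨ π≡#cliques (suc k) (blowUp G w) ⟨
    π (suc k) (blowUp G w) ∎
    where open ≤-Reasoning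

  π-≤-sum-C : AllPairs _≢_ (verts G) → (∀ u v → Adj G u v → w u ≡ 0 ⊎ w v ≡ 0) →
              ∀ k → π (suc k) (blowUp G w) ≤ sum (map (λ v → w v C suc k) (verts G))
  π-≤-sum-C distinct independent k = begin
    π (suc k) (blowUp G w)
      ≡⟨ π≡#cliques (suc k) (blowUp G w) ⟩
    #cliques (suc k) (concat (map copies (verts G)))
      ≤⟨ #cliques-concat-≤-sum-C k (map copies (verts G)) (AllPairs.map⁺ (AP.map copies-independent distinct)) ⟩
    sum (map (λ b → length b C suc k) (map copies (verts G)))
      ≡⟨ cong sum (trans (sym (map-∘ (verts G))) (map-cong (λ v → cong (_C suc k) (length-copies v)) (verts G))) ⟩
    sum (map (λ v → w v C suc k) (verts G)) ∎
    where
    open ≤-Reasoning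
    copies-independent : ∀ {u v} → u ≢ v → All (λ x → All (¬_ ∘ BlowAdj G w x) (copies v)) (copies u)
    copies-independent {u} {v} u≢v = All-copies u λ i → All-copies v λ j →
      λ { (inj₁ (u≡v , _)) → u≢v u≡v
        ; (inj₂ Auv) → [ (λ wu≡0 → ¬Fin0 (subst Fin wu≡0 i)) , (λ wv≡0 → ¬Fin0 (subst Fin wv≡0 j)) ]
                         (independent u v Auv) }

-- Symmetric chain decomposition of the Boolean lattice

-- SaturatedChain t b Xs: Xs is a chain listed from its top, of size t, down to its bottom,
-- of size b, with sizes decreasing one at a time.
data SaturatedChain {n : ℕ} : ℕ → ℕ → List (Subset n) → Set where
  single : ∀ {t} X → ∣ X ∣ ≡ t → SaturatedChain t t (X ∷ [])
  cons   : ∀ {t b Xs} X → ∣ X ∣ ≡ suc t → All (_⊊ X) Xs → SaturatedChain t b Xs →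
           SaturatedChain (suc t) b (X ∷ Xs)

record SymmetricChain (n : ℕ) : Set where
  constructor symmetricChain
  field
    {top bottom} : ℕ
    {elements}   : List (Subset n)
    saturated    : SaturatedChain top bottom elements
    symmetric    : top + bottom ≡ n

open SymmetricChain public

elementsOf : ∀ {n} → List (SymmetricChain n) → List (Subset n)
elementsOf = concatMap elements

module _ {n : ℕ} where

  saturated-allPairs : ∀ {t b Xs} → SaturatedChain {n} t b Xs → AllPairs (λ X Y → Y ⊊ X) Xs
  saturated-allPairs (single X _)       = [] ∷ []
  saturated-allPairs (cons X _ Xs⊊X Xs) = Xs⊊X ∷ saturated-allPairs Xs

  saturated-bottom≤top : ∀ {t b Xs} → SaturatedChain {n} t b Xs → b ≤ t
  saturated-bottom≤top (single X _)    = ≤-refl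
  saturated-bottom≤top (cons X _ _ Xs) = m≤n⇒m≤1+n (saturated-bottom≤top Xs)

  saturated-meets : ∀ {t b Xs} c → SaturatedChain {n} t b Xs → b ≤ c → c ≤ t →
                    Any (λ X → ∣ X ∣ ≡ c) Xs
  saturated-meets c (single X ∣X∣≡t) b≤c c≤t = here (trans ∣X∣≡t (≤-antisym b≤c c≤t))
  saturated-meets {suc t} c (cons X ∣X∣≡1+t _ Xs) b≤c c≤1+t with c ≟ suc t
  ... | yes refl = here ∣X∣≡1+t
  ... | no  c≢1+t = there (saturated-meets c Xs b≤c (≤-pred (≤∧≢⇒< c≤1+t c≢1+t)))

  ∷-⊊ : ∀ x {X Y : Subset n} → Y ⊊ X → (x ∷ Y) ⊊ (x ∷ X)
  ∷-⊊ x (Y⊆X , Y≢X) = s⊆s Y⊆X , Y≢X ∘ ∷-injectiveʳ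

  false∷-saturated : ∀ {t b Xs} → SaturatedChain {n} t b Xs → SaturatedChain t b (map (false ∷_) Xs)
  false∷-saturated (single X ∣X∣≡t)         = single (false ∷ X) ∣X∣≡t
  false∷-saturated (cons X ∣X∣≡1+t Xs⊊X Xs) =
    cons (false ∷ X) ∣X∣≡1+t (All.map⁺ (All.map (∷-⊊ false) Xs⊊X)) (false∷-saturated Xs)

  true∷-saturated : ∀ {t b Xs} → SaturatedChain {n} t b Xs → SaturatedChain (suc t) (suc b) (map (true ∷_) Xs)
  true∷-saturated (single X ∣X∣≡t)         = single (true ∷ X) (cong suc ∣X∣≡t)
  true∷-saturated (cons X ∣X∣≡1+t Xs⊊X Xs) =
    cons (true ∷ X) (cong suc ∣X∣≡1+t) (All.map⁺ (All.map (∷-⊊ true) Xs⊊X)) (true∷-saturated Xs)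

  saturated-grow : ∀ {t b X Xs} → SaturatedChain {n} t b (X ∷ Xs) →
                   SaturatedChain (suc t) b ((true ∷ X) ∷ map (false ∷_) (X ∷ Xs))
  saturated-grow {X = X} XXs =
    cons (true ∷ X) (cong suc (top-size XXs)) (All.map⁺ (All.map false⊊true (below-top XXs))) (false∷-saturated XXs)
    where
    top-size : ∀ {t b Xs} → SaturatedChain t b (X ∷ Xs) → ∣ X ∣ ≡ t
    top-size (single _ ∣X∣≡t)   = ∣X∣≡t
    top-size (cons _ ∣X∣≡t _ _) = ∣X∣≡t
    below-top : ∀ {t b Xs} → SaturatedChain t b (X ∷ Xs) → All (_⊆ X) (X ∷ Xs)
    below-top (single _ _)       = ⊆-refl ∷ []
    below-top (cons _ _ Xs⊊X _) = ⊆-refl ∷ All.map proj₁ Xs⊊X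
    false⊊true : ∀ {Y} → Y ⊆ X → (false ∷ Y) ⊊ (true ∷ X)
    false⊊true Y⊆X = out⊆ Y⊆X , λ ()

  -- 1X_t ⊃ 0X_t ⊃ … ⊃ 0X_b and 1X_{t-1} ⊃ … ⊃ 1X_b, from the chain X_t ⊃ … ⊃ X_b.
  successors : SymmetricChain n → List (SymmetricChain (suc n))
  successors (symmetricChain X@(single _ _) t+b≡n) = symmetricChain (saturated-grow X) (cong suc t+b≡n) ∷ []
  successors (symmetricChain {suc t} {b} XXs@(cons _ _ _ Xs) t+b≡n) =
    symmetricChain (saturated-grow XXs) (cong suc t+b≡n) ∷
    symmetricChain (true∷-saturated Xs) (cong suc (trans (+-suc t b) t+b≡n)) ∷ []

  successors-↭ : ∀ K → elementsOf (successors K) ↭ map (true ∷_) (elements K) ++ map (false ∷_) (elements K)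
  successors-↭ (symmetricChain (single _ _) _)   = ↭-reflexive (++-identityʳ _)
  successors-↭ (symmetricChain (cons {Xs = Xs} X _ _ _) _) = prep (true ∷ X) (begin
    map (false ∷_) (X ∷ Xs) ++ map (true ∷_) Xs ++ []
      ↭⟨ ++⁺ˡ (map (false ∷_) (X ∷ Xs)) (↭-reflexive (++-identityʳ _)) ⟩
    map (false ∷_) (X ∷ Xs) ++ map (true ∷_) Xs
      ↭⟨ ++-comm (map (false ∷_) (X ∷ Xs)) _ ⟩
    map (true ∷_) Xs ++ map (false ∷_) (X ∷ Xs) ∎)
    where open PermutationReasoning

symmetricChains : ∀ n → List (SymmetricChain n)
symmetricChains zero    = symmetricChain (single [] refl) refl ∷ []
symmetricChains (suc n) = concatMap successors (symmetricChains n)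

elementsOf-concatMap-successors : ∀ {n} (Ks : List (SymmetricChain n)) →
  elementsOf (concatMap successors Ks) ↭ map (true ∷_) (elementsOf Ks) ++ map (false ∷_) (elementsOf Ks)
elementsOf-concatMap-successors []       = ↭-refl
elementsOf-concatMap-successors (K ∷ Ks) = begin
  elementsOf (successors K ++ concatMap successors Ks)
    ≡⟨ concatMap-++ elements (successors K) (concatMap successors Ks) ⟩
  elementsOf (successors K) ++ elementsOf (concatMap successors Ks)
    ↭⟨ ++⁺ (successors-↭ K) (elementsOf-concatMap-successors Ks) ⟩
  (map (true ∷_) (elements K) ++ map (false ∷_) (elements K)) ++
  (map (true ∷_) (elementsOf Ks) ++ map (false ∷_) (elementsOf Ks))
    ↭⟨ ++-interchange (map (true ∷_) (elements K)) _ _ _ ⟩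
  (map (true ∷_) (elements K) ++ map (true ∷_) (elementsOf Ks)) ++
  (map (false ∷_) (elements K) ++ map (false ∷_) (elementsOf Ks))
    ≡⟨ cong₂ _++_ (map-++ (true ∷_) (elements K) _) (map-++ (false ∷_) (elements K) _) ⟨
  map (true ∷_) (elementsOf (K ∷ Ks)) ++ map (false ∷_) (elementsOf (K ∷ Ks)) ∎
  where
  open PermutationReasoning
  open CommutativeSemigroupProperties (CommutativeMonoid.commutativeSemigroup ++-commutativeMonoid)
    using () renaming (interchange to ++-interchange)

symmetricChains-↭ : ∀ n → elementsOf (symmetricChains n) ↭ allSubsets n
symmetricChains-↭ zero    = ↭-reflexive (++-identityʳ _)
symmetricChains-↭ (suc n) = ↭-trans (elementsOf-concatMap-successors (symmetricChains n))
                                    (++⁺ (map⁺ _ (symmetricChains-↭ n)) (map⁺ _ (symmetricChains-↭ n)))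

⌈t+b/2⌉-between : ∀ {b t} → b ≤ t → b ≤ ⌈ (t + b) /2⌉ × ⌈ (t + b) /2⌉ ≤ t
⌈t+b/2⌉-between {zero}  {t}     _          rewrite +-identityʳ t = z≤n , ⌈n/2⌉≤n t
⌈t+b/2⌉-between {suc b} {suc t} (s≤s b≤t) rewrite +-suc t b = Product.map s≤s s≤s (⌈t+b/2⌉-between b≤t)

symmetricChain-meets-middle : ∀ {n} (K : SymmetricChain n) → Any (λ X → ∣ X ∣ ≡ ⌈ n /2⌉) (elements K)
symmetricChain-meets-middle (symmetricChain Xs refl) =
  let b≤c , c≤t = ⌈t+b/2⌉-between (saturated-bottom≤top Xs) in saturated-meets _ Xs b≤c c≤t

p⊆q∧∣p∣≡∣q∣⇒p≡q : ∀ {n} {p q : Subset n} → p ⊆ q → ∣ p ∣ ≡ ∣ q ∣ → p ≡ q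
p⊆q∧∣p∣≡∣q∣⇒p≡q {p = []}        {[]}        _   _ = refl
p⊆q∧∣p∣≡∣q∣⇒p≡q {p = true ∷ p}  {true ∷ q}  p⊆q e =
  cong (true ∷_) (p⊆q∧∣p∣≡∣q∣⇒p≡q (drop-∷-⊆ p⊆q) (suc-injective e))
p⊆q∧∣p∣≡∣q∣⇒p≡q {p = false ∷ p} {false ∷ q} p⊆q e =
  cong (false ∷_) (p⊆q∧∣p∣≡∣q∣⇒p≡q (drop-∷-⊆ p⊆q) e)
p⊆q∧∣p∣≡∣q∣⇒p≡q {p = true ∷ p}  {false ∷ q} p⊆q _ with () ← p⊆q here
p⊆q∧∣p∣≡∣q∣⇒p≡q {p = false ∷ p} {true ∷ q}  p⊆q e =
  contradiction (p⊆q⇒∣p∣≤∣q∣ (drop-∷-⊆ p⊆q)) (<⇒≱ (≤-reflexive (sym e)))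

allSubsets-unique : ∀ n → AllPairs _≢_ (allSubsets n)
allSubsets-unique zero    = [] ∷ []
allSubsets-unique (suc n) = AllPairs.++⁺ (∷-unique true) (∷-unique false)
  (All.map⁺ (All.universal (λ _ → All.map⁺ (All.universal (λ _ ()) _)) _))
  where
  ∷-unique : ∀ x → AllPairs _≢_ (map (x ∷_) (allSubsets n))
  ∷-unique x = AllPairs.map⁺ (AP.map (_∘ ∷-injectiveʳ) (allSubsets-unique n))

middle? : ∀ n → Decidable (InMiddle n)
middle? n X = ∣ X ∣ ≟ ⌈ n /2⌉

middle-support-independent : ∀ {n} (w : Subset n → ℕ) → (∀ X → ¬ InMiddle n X → w X ≡ 0) →
                             ∀ X Y → Adj (Sperner n) X Y → w X ≡ 0 ⊎ w Y ≡ 0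
middle-support-independent {n} w off X Y X~Y with middle? n X | middle? n Y
... | no ¬mX | _      = inj₁ (off X ¬mX)
... | yes _  | no ¬mY = inj₂ (off Y ¬mY)
... | yes mX | yes mY = contradiction (trans mX (sym mY)) ([ ⊊⇒∣≢∣ , (λ Y⊊X → ⊊⇒∣≢∣ Y⊊X ∘ sym) ] X~Y)
  where
  ⊊⇒∣≢∣ : ∀ {p q : Subset n} → p ⊊ q → ∣ p ∣ ≢ ∣ q ∣
  ⊊⇒∣≢∣ (p⊆q , p≢q) = p≢q ∘ p⊆q∧∣p∣≡∣q∣⇒p≡q p⊆q

#symmetricChains≤#middleLayer : ∀ n → length (symmetricChains n) ≤ length (middleLayer n)
#symmetricChains≤#middleLayer n = begin
  length (symmetricChains n)
    ≤⟨ length-≤-filter-concatMap (middle? n) elements _ (All.universal symmetricChain-meets-middle (symmetricChains n)) ⟩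
  length (filter (middle? n) (elementsOf (symmetricChains n)))
    ≡⟨ ↭-length (filter-↭ (middle? n) (symmetricChains-↭ n)) ⟩
  length (middleLayer n) ∎
  where open ≤-Reasoning

sum-middleLayer : ∀ {n} (f : Subset n → ℕ) → (∀ X → ¬ InMiddle n X → f X ≡ 0) →
                  sum (map f (middleLayer n)) ≡ sum (map f (allSubsets n))
sum-middleLayer {n} f off = sum-map-filter (middle? n) f off (allSubsets n)

sum-symmetricChains : ∀ {n} (w : Subset n → ℕ) →
                      sum (map (sum ∘ map w) (map elements (symmetricChains n))) ≡ sum (map w (allSubsets n))
sum-symmetricChains {n} w = trans (sym (sum-map-concat w (map elements (symmetricChains n))))
                                  (sum-↭ (map⁺ w (symmetricChains-↭ n)))

⌈/⌉≡⌊/⌋⊎1+⌊/⌋ : ∀ m d → ⌈ m / d ⌉ ≡ ⌊ m / d ⌋ ⊎ ⌈ m / d ⌉ ≡ suc ⌊ m / d ⌋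
⌈/⌉≡⌊/⌋⊎1+⌊/⌋ m zero    = inj₁ refl
⌈/⌉≡⌊/⌋⊎1+⌊/⌋ m (suc d) = between (/-monoˡ-≤ (suc d) (m≤m+n m d)) ⌈m/d⌉≤1+⌊m/d⌋
  where
  between : ∀ {a x} → a ≤ x → x ≤ suc a → x ≡ a ⊎ x ≡ suc a
  between a≤x x≤1+a = Sum.map₁ (λ x<1+a → ≤-antisym (≤-pred x<1+a) a≤x) (m≤n⇒m<n∨m≡n x≤1+a)
  ⌈m/d⌉≤1+⌊m/d⌋ : (m + d) / suc d ≤ suc (m / suc d)
  ⌈m/d⌉≤1+⌊m/d⌋ = begin
    (m + d) / suc d                    ≤⟨ /-monoˡ-≤ (suc d) (+-monoʳ-≤ m (n≤1+n d)) ⟩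
    (m + suc d) / suc d                ≡⟨ m/n≡1+[m∸n]/n (m≤n+m (suc d) m) ⟩
    suc ((m + suc d ∸ suc d) / suc d)  ≡⟨ cong (λ x → suc (x / suc d)) (m+n∸n≡m m (suc d)) ⟩
    suc (m / suc d)                    ∎
    where open ≤-Reasoning

uniform⇒balanced : ∀ {n} w m → UniformOnMiddle n w m →
                   let q = ⌊ m / length (middleLayer n) ⌋ in All (λ X → w X ≡ q ⊎ w X ≡ suc q) (middleLayer n)
uniform⇒balanced {n} w m (_ , on) = All.map balanced (All.all-filter (middle? n) (allSubsets n))
  where
  N q : ℕ
  N = length (middleLayer n)
  q = ⌊ m / N ⌋
  balanced : ∀ {X} → InMiddle n X → w X ≡ q ⊎ w X ≡ suc q
  balanced {X} mX = [ inj₁ , (λ e → Sum.map (trans e) (trans e) (⌈/⌉≡⌊/⌋⊎1+⌊/⌋ m N)) ]′ (on X mX)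

theorem5 : (n m k : ℕ) → n ≥ 1 → m ≥ 1 → k ≥ 2 → (w w′ : Subset n → ℕ) → IsWeighting (Sperner n) w m → IsWeighting (Sperner n) w′ m → UniformOnMiddle n w′ m → π k (blowUp (Sperner n) w′) ≤ π k (blowUp (Sperner n) w)
theorem5 n m (suc k) _ _ (s≤s _) w w′ Σw≡m Σw′≡m w′-uniform@(off , _) = begin
  π (suc k) (blowUp (Sperner n) w′)
    ≤⟨ BlowUp.π-≤-sum-C (Sperner n) w′ (allSubsets-unique n) (middle-support-independent w′ off) k ⟩
  sum (map (λ X → w′ X C suc k) (allSubsets n))
    ≡⟨ sum-middleLayer (λ X → w′ X C suc k) (λ X ¬mX → cong (_C suc k) (off X ¬mX)) ⟨
  sum (map (λ X → w′ X C suc k) (middleLayer n))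
    ≤⟨ sum-C-balanced-≤ w′ (sum ∘ map w) _ k _ chains (uniform⇒balanced w′ m w′-uniform) Σw′≡Σw #chains≤ ⟩
  sum (map (λ c → sum (map w c) C suc k) chains)
    ≤⟨ BlowUp.sum-C-≤-π (Sperner n) w Sum.swap k chains chains-cliques (symmetricChains-↭ n) ⟩
  π (suc k) (blowUp (Sperner n) w) ∎
  where
  open ≤-Reasoning
  chains : List (List (Subset n))
  chains = map elements (symmetricChains n)
  chains-cliques : All (AllPairs (Adj (Sperner n))) chains
  chains-cliques = All.map⁺ (All.universal (λ K → AP.map inj₂ (saturated-allPairs (saturated K))) _)
  Σw′≡Σw : sum (map w′ (middleLayer n)) ≡ sum (map (sum ∘ map w) chains)
  Σw′≡Σw = trans (sum-middleLayer w′ off) (trans (trans Σw′≡m (sym Σw≡m)) (sym (sum-symmetricChains w)))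
  #chains≤ : length chains ≤ length (middleLayer n)
  #chains≤ = ≤-trans (≤-reflexive (length-map elements (symmetricChains n))) (#symmetricChains≤#middleLayer n)
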